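{- Let $x,y:\mathbb{R}_D$ be equipped with locators. Then one can construct locators for $-x$, $x+y$, $x\cdot y$, $\min(x,y)$ and $\max(x,y)$, and, given a proof of $x\mathrel{\#}0$, a locator for $x^{ -1}$.
   Context: Work in Martin-Löf type theory with propositional truncation, function extensionality and propositional extensionality. A Dedekind real is a pair $x=(L,U)$ of proposition-valued predicates on $\mathbb{Q}$, writing $q<x$ for $q\in L$ and $x<r$ for $r\in U$, which is bounded, rounded, transitive and located ($q<r\Rightarrow\|(q<x)+(x<r)\|$). $\mathbb{R}_D$ is the type of Dedekind reals; $x<y:=\exists_{q:\mathbb{Q}}(x<q)\land(q<y)$, and $x\mathrel{\#}y:=(x<y)\lor(y<x)$. The algebraic operations are the usual ones on Dedekind cuts, characterized by: $q<-x\Leftrightarrow x<-q$; $-x<r\Leftrightarrow -r<x$; $q<x+y\Leftrightarrow\exists s.\,s<x\land q-s<y$; $x+y<r\Leftrightarrow\exists t.\,x<t\land y<r-t$; $q<xy\Leftrightarrow\exists a,b,c,d:\mathbb{Q}.\,q<\min(ac,ad,bc,bd)\land a<x<b\land c<y<d$; $xy<r\Leftrightarrow\exists a,b,c,d.\,\max(ac,ad,bc,bd)<r\land a<x<b\land c<y<d$; for $z>0$: $q<z^{ -1}\Leftrightarrow qz<1$, $z^{ -1}<r\Leftrightarrow 1<rz$; for $w<0$: $q<w^{ -1}\Leftrightarrow 1<qw$, $w^{ -1}<r\Leftrightarrow rw<1$; $q<\min(x,y)\Leftrightarrow q<x\land q<y$; $\min(x,y)<r\Leftrightarrow x<r\lor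 y<r$; $q<\max(x,y)\Leftrightarrow q<x\lor q<y$; $\max(x,y)<r\Leftrightarrow x<r\land y<r$. A locator for $x$ is a function $\prod_{q,r:\mathbb{Q}}(q<r)\to(q<x)+(x<r)$ into the untruncated disjoint sum. -}

module Defs where

open import Data.Rational using (ℚ; 0ℚ; 1ℚ; _<_; _+_; _-_; -_; _*_; _⊓_; _⊔_)
open import Data.Product using (Σ; _×_; _,_)
open import Data.Sum using (_⊎_)
open import Relation.Binary.PropositionalEquality using (_≡_)

isProp : Set → Set
isProp A = (a b : A) → a ≡ b

record PropTrunc : Set₁ where
  field
    ∥_∥      : Set → Set
    ∣_∣      : {A : Set} → A → ∥ A ∥
    ∥∥-isProp : {A : Set} → isProp ∥ A ∥
    ∥∥-rec   : {A B : Set} → isProp B → (A → B) → ∥ A ∥ → B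

FunExt : Set₁
FunExt = {A : Set} {B : A → Set} {f g : (a : A) → B a} → ((a : A) → f a ≡ g a) → f ≡ g

PropExt : Set₁
PropExt = {P Q : Set} → isProp P → isProp Q → (P → Q) → (Q → P) → P ≡ Q

_⇔_ : Set → Set → Set
A ⇔ B = (A → B) × (B → A)

record Cut : Set₁ where
  constructor cut
  field
    lower : ℚ → Set   -- q ∈ L  i.e.  q < x
    upper : ℚ → Set   -- r ∈ U  i.e.  x < r
open Cut public

Locator : Cut → Set
Locator x = (q r : ℚ) → q < r → lower x q ⊎ upper x r

module Reals (T : PropTrunc) where
  open PropTrunc T public

  _∨_ : Set → Set → Set
  A ∨ B = ∥ A ⊎ B ∥

  ∃ℚ : (ℚ → Set) → Set
  ∃ℚ P = ∥ Σ ℚ P ∥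

  record ℝD : Set₁ where
    field
      L U      : ℚ → Set
      L-prop   : (q : ℚ) → isProp (L q)
      U-prop   : (r : ℚ) → isProp (U r)
      bounded-L : ∃ℚ L
      bounded-U : ∃ℚ U
      rounded-L : (q : ℚ) → L q ⇔ ∃ℚ (λ q' → (q < q') × L q')
      rounded-U : (r : ℚ) → U r ⇔ ∃ℚ (λ r' → (r' < r) × U r')
      transitive : (q r : ℚ) → L q → U r → q < r
      located  : (q r : ℚ) → q < r → L q ∨ U r

  cutOf : ℝD → Cut
  cutOf x = cut (ℝD.L x) (ℝD.U x)

  _<ᶜ_ : Cut → Cut → Set
  x <ᶜ y = ∃ℚ (λ q → upper x q × lower y q)

  ι : ℚ → Cut
  ι q = cut (λ s → s < q) (λ r → q < r)

  _#0 : Cut → Set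
  x #0 = (x <ᶜ ι 0ℚ) ∨ (ι 0ℚ <ᶜ x)

  negᶜ : Cut → Cut
  negᶜ x = cut (λ q → upper x (- q)) (λ r → lower x (- r))

  addᶜ : Cut → Cut → Cut
  addᶜ x y = cut (λ q → ∃ℚ (λ s → lower x s × lower y (q - s)))
                 (λ r → ∃ℚ (λ t → upper x t × upper y (r - t)))

  min4 max4 : ℚ → ℚ → ℚ → ℚ → ℚ
  min4 a b c d = (a ⊓ b) ⊓ (c ⊓ d)
  max4 a b c d = (a ⊔ b) ⊔ (c ⊔ d)

  ∃abcd : Cut → Cut → (ℚ → ℚ → ℚ → ℚ → Set) → Set
  ∃abcd x y P = ∥ Σ ℚ (λ a → Σ ℚ (λ b → Σ ℚ (λ c → Σ ℚ (λ d →
                   P a b c d × (lower x a × upper x b) × (lower y c × upper y d))))) ∥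

  mulᶜ : Cut → Cut → Cut
  mulᶜ x y = cut (λ q → ∃abcd x y (λ a b c d → q < min4 (a * c) (a * d) (b * c) (b * d)))
                 (λ r → ∃abcd x y (λ a b c d → max4 (a * c) (a * d) (b * c) (b * d) < r))

  minᶜ : Cut → Cut → Cut
  minᶜ x y = cut (λ q → lower x q × lower y q) (λ r → upper x r ∨ upper y r)

  maxᶜ : Cut → Cut → Cut
  maxᶜ x y = cut (λ q → lower x q ∨ lower y q) (λ r → upper x r × upper y r)

  invᶜ : Cut → Cut
  invᶜ z = cut
    (λ q → ((ι 0ℚ <ᶜ z) × (mulᶜ (ι q) z <ᶜ ι 1ℚ)) ∨ ((z <ᶜ ι 0ℚ) × (ι 1ℚ <ᶜ mulᶜ (ι q) z)))
    (λ r → ((ι 0ℚ <ᶜ z) × (ι 1ℚ <ᶜ mulᶜ (ι r) z)) ∨ ((z <ᶜ ι 0ℚ) × (mulᶜ (ι r) z <ᶜ ι 1ℚ)))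

-- A locator makes the truncated information about x computable.  The first index at which a
-- decidable test succeeds is unique, so searching ℕ with the locator extracts explicit rational
-- bounds of x (and, from x # 0, its sign) from their truncated existence; a finite scan between
-- the bounds then encloses x in a rational interval of any prescribed width.  Negation, min and
-- max are located pointwise.  For x + y and x y, enclosures so narrow that the resulting interval
-- around the sum or product is shorter than r - q decide between q and r.  For positive x and
-- 0 < q < r, deciding q < x⁻¹ or x⁻¹ < r amounts to deciding x < 1/q or 1/r < x, which the
-- locator of x does at any two rationals strictly between 1/r and 1/q; negative x is symmetric.
module Submission where

open import Defs
open import Data.Bool using (Bool; true; false; T; not; _∧_)
open import Data.Bool.Properties using (T-irrelevant)
open import Data.Empty using (⊥-elim)
import Data.Integer as ℤ
import Data.Integer.Properties as ℤ
import Data.Integer.Solver as ℤSolver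
open import Data.Nat as ℕ using (ℕ; zero; suc)
import Data.Nat.Properties as ℕ
open import Data.Nat.Coprimality using (1-coprimeTo)
open import Data.Product using (Σ; _×_; _,_; proj₁; proj₂)
open import Data.Rational
  using (ℚ; mkℚ; *<*; *≤*; 0ℚ; 1ℚ; ½; _<_; _≤_; _+_; _-_; -_; _*_; _⊔_; 1/_;
         NonZero; Positive; positive; nonNegative; nonPositive)
import Data.Rational as ℚ
open import Data.Rational.Literals using (fromℤ)
open import Data.Rational.Properties
open import Data.Rational.Solver
import Data.Rational.Unnormalised as ℚᵘ
import Data.Rational.Unnormalised.Properties as ℚᵘ
open import Data.Sum as Sum using (_⊎_; inj₁; inj₂; swap; [_,_]′)
open import Data.Unit using (tt)
open import Function using (_∘_)
open import Relation.Binary.Definitions using (tri<; tri≈; tri>)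
open import Relation.Binary.PropositionalEquality
open import Relation.Nullary using (¬_; Dec; yes; no)

-- Unique choice for decidable predicates on ℕ

module UniqueChoice (PT : PropTrunc) where
  open PropTrunc PT

  noneBelow : (ℕ → Bool) → ℕ → Bool
  noneBelow p zero    = true
  noneBelow p (suc n) = not (p n) ∧ noneBelow p n

  Least : (ℕ → Bool) → ℕ → Set
  Least p n = T (p n) × T (noneBelow p n)

  noneBelow-sound : ∀ p {m n} → T (noneBelow p n) → m ℕ.< n → ¬ T (p m)
  noneBelow-sound p {m} {suc n} none m<1+n pm with p n in eq | ℕ.m<1+n⇒m<n∨m≡n m<1+n
  ... | false | inj₁ m<n  = noneBelow-sound p none m<n pm
  ... | false | inj₂ refl = subst T eq pm
  ... | true  | _         = none

  Least-isProp : ∀ p → isProp (Σ ℕ (Least p))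
  Least-isProp p (m , pm , nm) (n , pn , nn) with ℕ.<-cmp m n
  ... | tri< m<n _ _ = ⊥-elim (noneBelow-sound p nn m<n pm)
  ... | tri> _ _ n<m = ⊥-elim (noneBelow-sound p nm n<m pn)
  ... | tri≈ _ refl _ with T-irrelevant pm pn | T-irrelevant nm nn
  ...   | refl | refl = refl

  noneBelow-or-least : ∀ p n → T (noneBelow p n) ⊎ Σ ℕ (Least p)
  noneBelow-or-least p zero = inj₁ tt
  noneBelow-or-least p (suc n) with noneBelow-or-least p n
  ... | inj₂ least = inj₂ least
  ... | inj₁ none with p n in eq
  ...   | true  = inj₂ (n , subst T (sym eq) tt , none)
  ...   | false = inj₁ none

  least : ∀ p {n} → T (p n) → Σ ℕ (Least p)
  least p {n} pn with noneBelow-or-least p (suc n)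
  ... | inj₂ l    = l
  ... | inj₁ none = ⊥-elim (noneBelow-sound p none (ℕ.n<1+n n) pn)

  search : ∀ p → ∥ Σ ℕ (T ∘ p) ∥ → Σ ℕ (T ∘ p)
  search p h with ∥∥-rec (Least-isProp p) (λ (n , pn) → least p pn) h
  ... | n , pn , _ = n , pn

  isInj₁ : {A B : Set} → A ⊎ B → Bool
  isInj₁ (inj₁ _) = true
  isInj₁ (inj₂ _) = false

  searchInj₁ : {A B : ℕ → Set} (f : ∀ n → A n ⊎ B n) → ∥ Σ ℕ (λ n → ¬ B n) ∥ → Σ ℕ A
  searchInj₁ {A} {B} f h =
    let n , t = search (isInj₁ ∘ f) (∥∥-rec ∥∥-isProp (λ (n , ¬Bn) → ∣ n , inj₁-if-¬B (f n) ¬Bn ∣) h)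
    in n , fromInj₁ (f n) t
    where
    inj₁-if-¬B : ∀ {n} (e : A n ⊎ B n) → ¬ B n → T (isInj₁ e)
    inj₁-if-¬B (inj₁ _) _  = tt
    inj₁-if-¬B (inj₂ b) ¬b = ¬b b
    fromInj₁ : ∀ {n} (e : A n ⊎ B n) → T (isInj₁ e) → A n
    fromInj₁ (inj₁ a) _ = a

fromℕ : ℕ → ℚ
fromℕ n = fromℤ (ℤ.+ n)

-- Rational addition normalises, so the identity is checked on unnormalised representatives.
fromℕ-suc : ∀ n → fromℕ (suc n) ≡ 1ℚ + fromℕ n
fromℕ-suc n = sym (toℚᵘ-injective (ℚᵘ.≃-trans (toℚᵘ-homo-+ 1ℚ (fromℕ n)) (ℚᵘ.*≡*
  (solve 1 (λ k → (con (ℤ.+ 1) :* con (ℤ.+ 1) :+ k :* con (ℤ.+ 1)) :* con (ℤ.+ 1) := (con (ℤ.+ 1) :+ k) :* (con (ℤ.+ 1) :* con (ℤ.+ 1)))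
         refl (ℤ.+ n)))))
  where open ℤSolver.+-*-Solver

open +-*-Solver

archimedean : ∀ p → Σ ℕ λ n → p < fromℕ n
archimedean (mkℚ (ℤ.+ k) d _) = suc k , *<* (ℤ.≤-<-trans (ℤ.≤-reflexive (ℤ.*-identityʳ (ℤ.+ k)))
  (ℤ.+<+ (ℕ.<-≤-trans (ℕ.n<1+n k) (ℕ.m≤m*n (suc k) (suc d)))))
archimedean (mkℚ ℤ.-[1+ k ] d _) = 0 , *<* ℤ.-<+

unitFraction : ℕ → ℚ
unitFraction n = mkℚ (ℤ.+ 1) n (1-coprimeTo (suc n))

0<unitFraction : ∀ n → 0ℚ < unitFraction n
0<unitFraction n = positive⁻¹ (unitFraction n)

unitFraction-≤ : ∀ {p} → 0ℚ < p → Σ ℕ λ n → unitFraction n ≤ p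
unitFraction-≤ {mkℚ ℤ.+[1+ k ] d _} _ =
  d , *≤* (ℤ.+≤+ (ℕ.≤-trans (ℕ.≤-reflexive (ℕ.*-identityˡ (suc d))) (ℕ.m≤n*m (suc d) (suc k))))
unitFraction-≤ {mkℚ (ℤ.+ 0) d _} (*<* (ℤ.+<+ ()))
unitFraction-≤ {mkℚ ℤ.-[1+ k ] d _} (*<* ())

neg-involutive : ∀ p → - - p ≡ p
neg-involutive = solve 1 (λ p → :- (:- p) := p) refl

0<1 : 0ℚ < 1ℚ
0<1 = positive⁻¹ 1ℚ

p<p+q : ∀ p {q} → 0ℚ < q → p < p + q
p<p+q p {q} 0<q = subst (_< p + q) (+-identityʳ p) (+-monoʳ-< p 0<q)

p-q<p : ∀ p {q} → 0ℚ < q → p - q < p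
p-q<p p {q} 0<q = subst (p - q <_) (solve 2 (λ p q → p :- q :+ q := p) refl p q) (p<p+q (p - q) 0<q)

p<q⇒0<q-p : ∀ {p q} → p < q → 0ℚ < q - p
p<q⇒0<q-p {p} {q} p<q = subst (_< q - p) (+-inverseʳ p) (+-monoˡ-< (- p) p<q)

p<q-r⇒r+p<q : ∀ {p q r} → p < q - r → r + p < q
p<q-r⇒r+p<q {p} {q} {r} p<q-r = subst (r + p <_) (solve 2 (λ q r → r :+ (q :- r) := q) refl q r) (+-monoʳ-< r p<q-r)

p<q-r⇒r<q-p : ∀ {p q r} → p < q - r → r < q - p
p<q-r⇒r<q-p {p} {q} {r} p<q-r =
  subst (_< q - p) (solve 2 (λ p r → r :+ p :- p := r) refl p r) (+-monoˡ-< (- p) (p<q-r⇒r+p<q {p} {q} {r} p<q-r))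

p-ε≤q⇒p+ε<r : ∀ {p q r ε} → p - ε ≤ q → ε + ε < r - q → p + ε < r
p-ε≤q⇒p+ε<r {p} {q} {r} {ε} p-ε≤q 2ε<r-q = begin-strict
  p + ε              ≡⟨ solve 2 (λ p ε → p :+ ε := p :- ε :+ (ε :+ ε)) refl p ε ⟩
  p - ε + (ε + ε)    ≤⟨ +-monoˡ-≤ (ε + ε) p-ε≤q ⟩
  q + (ε + ε)        <⟨ +-monoʳ-< q 2ε<r-q ⟩
  q + (r - q)        ≡⟨ solve 2 (λ q r → q :+ (r :- q) := r) refl q r ⟩
  r                  ∎
  where open ≤-Reasoning

+-fromℕ-suc-* : ∀ s η N → s + fromℕ (suc N) * η ≡ s + η + fromℕ N * η
+-fromℕ-suc-* s η N = trans (cong (λ n → s + n * η) (fromℕ-suc N))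
                             (solve 3 (λ s η n → s :+ (con 1ℚ :+ n) :* η := s :+ η :+ n :* η) refl s η (fromℕ N))

halve : ∀ {δ} → 0ℚ < δ → 0ℚ < ½ * δ × ½ * δ < δ
halve {δ} 0<δ = subst (_< ½ * δ) (*-zeroʳ ½) (*-monoʳ-<-pos ½ 0<δ) ,
                subst (½ * δ <_) (*-identityˡ δ) (*-monoˡ-<-pos δ {{positive 0<δ}} {½} {1ℚ} (*<* (ℤ.+<+ (ℕ.s≤s (ℕ.s≤s ℕ.z≤n)))))

nonPos*nonNeg≤0 : ∀ {p q} → p ≤ 0ℚ → 0ℚ ≤ q → p * q ≤ 0ℚ
nonPos*nonNeg≤0 {p} {q} p≤0 0≤q = nonPositive⁻¹ _ {{nonPos*nonNeg⇒nonPos p {{nonPositive p≤0}} q {{nonNegative 0≤q}}}}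

nonNeg*nonPos≤0 : ∀ {p q} → 0ℚ ≤ p → q ≤ 0ℚ → p * q ≤ 0ℚ
nonNeg*nonPos≤0 {p} {q} 0≤p q≤0 = nonPositive⁻¹ _ {{nonNeg*nonPos⇒nonPos p {{nonNegative 0≤p}} q {{nonPositive q≤0}}}}

*-mono-≤-nonNeg : ∀ {p q r s} → 0ℚ ≤ p → 0ℚ ≤ r → p ≤ q → r ≤ s → p * r ≤ q * s
*-mono-≤-nonNeg {p} {q} {r} {s} 0≤p 0≤r p≤q r≤s =
  ≤-trans (*-monoʳ-≤-nonNeg r {{nonNegative 0≤r}} p≤q) (*-monoˡ-≤-nonNeg q {{nonNegative (≤-trans 0≤p p≤q)}} r≤s)

positive-inverse : ∀ {p} → 0ℚ < p → Σ ℚ λ p⁻¹ → 0ℚ < p⁻¹ × p * p⁻¹ ≡ 1ℚ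
positive-inverse {p} 0<p = 1/ p , positive⁻¹ (1/ p) {{1/pos⇒pos p}} , *-inverseʳ p
  where instance
  p-pos : Positive p
  p-pos = positive 0<p
  p≢0 : NonZero p
  p≢0 = pos⇒nonZero p

archimedean-scaled : ∀ {δ} → 0ℚ < δ → ∀ p → Σ ℕ λ n → p < fromℕ n * δ
archimedean-scaled {δ} 0<δ p =
  let δ⁻¹ , _ , δδ⁻¹≡1 = positive-inverse 0<δ
      n , pδ⁻¹<n = archimedean (p * δ⁻¹)
      pδ⁻¹δ≡p = trans (solve 3 (λ p δ δ⁻¹ → p :* δ⁻¹ :* δ := p :* (δ :* δ⁻¹)) refl p δ δ⁻¹)
                      (trans (cong (p *_) δδ⁻¹≡1) (*-identityʳ p))
  in n , subst (_< fromℕ n * δ) pδ⁻¹δ≡p (*-monoˡ-<-pos δ {{positive 0<δ}} pδ⁻¹<n)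

small-factor : ∀ {K ε} → 0ℚ ≤ K → 0ℚ < ε → Σ ℚ λ η → 0ℚ < η × η ≤ 1ℚ × η * K < ε
small-factor {K} {ε} 0≤K 0<ε = η , 0<η , η≤1 , ηK<ε
  where
  open ≤-Reasoning
  D : ℚ
  D = K + ε
  0<D : 0ℚ < D
  0<D = subst (_< D) (+-identityˡ 0ℚ) (+-mono-≤-< 0≤K 0<ε)
  D⁻¹ η : ℚ
  D⁻¹ = proj₁ (positive-inverse 0<D)
  η = ε * D⁻¹
  ηD≡ε : η * D ≡ ε
  ηD≡ε = begin-equality
    ε * D⁻¹ * D   ≡⟨ solve 3 (λ ε D D⁻¹ → ε :* D⁻¹ :* D := ε :* (D :* D⁻¹)) refl ε D D⁻¹ ⟩
    ε * (D * D⁻¹) ≡⟨ cong (ε *_) (proj₂ (proj₂ (positive-inverse 0<D))) ⟩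
    ε * 1ℚ        ≡⟨ *-identityʳ ε ⟩
    ε             ∎
  0<η : 0ℚ < η
  0<η = subst (_< η) (*-zeroˡ D⁻¹) (*-monoˡ-<-pos D⁻¹ {{positive (proj₁ (proj₂ (positive-inverse 0<D)))}} 0<ε)
  η≤1 : η ≤ 1ℚ
  η≤1 = *-cancelʳ-≤-pos D {{positive 0<D}} (begin
    η * D    ≡⟨ ηD≡ε ⟩
    ε        ≤⟨ subst (_≤ D) (+-identityˡ ε) (+-monoˡ-≤ ε 0≤K) ⟩
    D        ≡⟨ sym (*-identityˡ D) ⟩
    1ℚ * D   ∎)
  ηK<ε : η * K < ε
  ηK<ε = begin-strict
    η * K    <⟨ *-monoʳ-<-pos η {{positive 0<η}} (p<p+q K 0<ε) ⟩
    η * D    ≡⟨ ηD≡ε ⟩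
    ε        ∎

reciprocal-gap : ∀ {q r} → 0ℚ < q → q < r → Σ ℚ λ u → Σ ℚ λ v → u < v × 1ℚ < r * u × q * v < 1ℚ
reciprocal-gap {q} {r} 0<q q<r =
  let m , q<m , m<r = <-dense q<r
      m′ , m<m′ , m′<r = <-dense m<r
      0<m = <-trans 0<q q<m
      v , 0<v , mv≡1 = positive-inverse 0<m
      u , 0<u , m′u≡1 = positive-inverse (<-trans 0<m m<m′)
      open ≤-Reasoning
      u<v = *-cancelˡ-<-nonNeg m {{nonNegative (<⇒≤ 0<m)}} (begin-strict
        m * u    <⟨ *-monoˡ-<-pos u {{positive 0<u}} m<m′ ⟩
        m′ * u   ≡⟨ trans m′u≡1 (sym mv≡1) ⟩
        m * v    ∎)
      1<ru = begin-strict
        1ℚ       ≡⟨ sym m′u≡1 ⟩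
        m′ * u   <⟨ *-monoˡ-<-pos u {{positive 0<u}} m′<r ⟩
        r * u    ∎
      qv<1 = begin-strict
        q * v    <⟨ *-monoˡ-<-pos v {{positive 0<v}} q<m ⟩
        m * v    ≡⟨ mv≡1 ⟩
        1ℚ       ∎
  in u , v , u<v , 1<ru , qv<1

reciprocal-gap-neg : ∀ {q r} → q < r → r < 0ℚ → Σ ℚ λ u → Σ ℚ λ v → u < v × r * u < 1ℚ × 1ℚ < q * v
reciprocal-gap-neg {q} {r} q<r r<0 =
  let u , v , u<v , 1<-qu , -rv<1 = reciprocal-gap (neg-antimono-< r<0) (neg-antimono-< q<r)
  in - v , - u , neg-antimono-< u<v , subst (_< 1ℚ) (neg-swap r v) -rv<1 , subst (1ℚ <_) (neg-swap q u) 1<-qu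
  where
  neg-swap : ∀ p p′ → - p * p′ ≡ p * - p′
  neg-swap = solve 2 (λ p p′ → :- p :* p′ := p :* (:- p′)) refl

p≤∣p∣ : ∀ p → p ≤ ℚ.∣ p ∣
p≤∣p∣ p with ≤-total 0ℚ p
... | inj₁ 0≤p = ≤-reflexive (sym (0≤p⇒∣p∣≡p 0≤p))
... | inj₂ p≤0 = ≤-trans p≤0 (nonNegative⁻¹ ℚ.∣ p ∣ {{∣-∣-nonNeg p}})

-p≤∣p∣ : ∀ p → - p ≤ ℚ.∣ p ∣
-p≤∣p∣ p = subst (- p ≤_) (∣-p∣≡∣p∣ p) (p≤∣p∣ (- p))

∣p∣≤∣q∣⊔∣r∣ : ∀ {p q r} → q ≤ p → p ≤ r → ℚ.∣ p ∣ ≤ ℚ.∣ q ∣ ⊔ ℚ.∣ r ∣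
∣p∣≤∣q∣⊔∣r∣ {p} {q} {r} q≤p p≤r with ∣p∣≡p∨∣p∣≡-p p
... | inj₁ ∣p∣≡p  = ≤-trans (≤-reflexive ∣p∣≡p) (≤-trans (≤-trans p≤r (p≤∣p∣ r)) (p≤q⊔p ℚ.∣ q ∣ ℚ.∣ r ∣))
... | inj₂ ∣p∣≡-p = ≤-trans (≤-reflexive ∣p∣≡-p) (≤-trans (≤-trans (neg-antimono-≤ q≤p) (-p≤∣p∣ q)) (p≤p⊔q ℚ.∣ q ∣ ℚ.∣ r ∣))

p≤q+∣p-q∣ : ∀ p q → p ≤ q + ℚ.∣ p - q ∣
p≤q+∣p-q∣ p q = subst (_≤ q + ℚ.∣ p - q ∣) (solve 2 (λ p q → q :+ (p :- q) := p) refl p q) (+-monoʳ-≤ q (p≤∣p∣ (p - q)))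

∣p-q∣≤ε⇒q-ε≤p≤q+ε : ∀ {p q ε} → ℚ.∣ p - q ∣ ≤ ε → q - ε ≤ p × p ≤ q + ε
∣p-q∣≤ε⇒q-ε≤p≤q+ε {p} {q} {ε} ∣p-q∣≤ε = q-ε≤p , p≤q+ε
  where
  open ≤-Reasoning
  ∣q-p∣≡∣p-q∣ : ℚ.∣ q - p ∣ ≡ ℚ.∣ p - q ∣
  ∣q-p∣≡∣p-q∣ = trans (cong ℚ.∣_∣ (solve 2 (λ p q → q :- p := :- (p :- q)) refl p q)) (∣-p∣≡∣p∣ (p - q))
  p≤q+ε : p ≤ q + ε
  p≤q+ε = ≤-trans (p≤q+∣p-q∣ p q) (+-monoʳ-≤ q ∣p-q∣≤ε)
  q-ε≤p : q - ε ≤ p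
  q-ε≤p = begin
    q - ε                  ≤⟨ +-monoˡ-≤ (- ε) (≤-trans (p≤q+∣p-q∣ q p) (+-monoʳ-≤ p (≤-reflexive ∣q-p∣≡∣p-q∣))) ⟩
    p + ℚ.∣ p - q ∣ - ε    ≤⟨ +-monoˡ-≤ (- ε) (+-monoʳ-≤ p ∣p-q∣≤ε) ⟩
    p + ε - ε              ≡⟨ solve 2 (λ p ε → p :+ ε :- ε := p) refl p ε ⟩
    p                      ∎

∣p-p∣≤ε : ∀ p {ε} → 0ℚ ≤ ε → ℚ.∣ p - p ∣ ≤ ε
∣p-p∣≤ε p 0≤ε = subst (λ d → ℚ.∣ d ∣ ≤ _) (sym (+-inverseʳ p)) 0≤ε

∣p+ε-p∣≤ε : ∀ p {ε} → 0ℚ ≤ ε → ℚ.∣ p + ε - p ∣ ≤ ε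
∣p+ε-p∣≤ε p {ε} 0≤ε = ≤-reflexive (trans (cong ℚ.∣_∣ (solve 2 (λ p ε → p :+ ε :- p := ε) refl p ε)) (0≤p⇒∣p∣≡p 0≤ε))

∣p-ε-p∣≤ε : ∀ p {ε} → 0ℚ ≤ ε → ℚ.∣ p - ε - p ∣ ≤ ε
∣p-ε-p∣≤ε p {ε} 0≤ε =
  ≤-reflexive (trans (cong ℚ.∣_∣ (solve 2 (λ p ε → p :- ε :- p := :- ε) refl p ε)) (trans (∣-p∣≡∣p∣ ε) (0≤p⇒∣p∣≡p 0≤ε)))

∣p*r-q*r∣≤ : ∀ {p q r w K} → ℚ.∣ p - q ∣ ≤ w → ℚ.∣ r ∣ ≤ K → ℚ.∣ p * r - q * r ∣ ≤ w * K
∣p*r-q*r∣≤ {p} {q} {r} {w} {K} ∣p-q∣≤w ∣r∣≤K = begin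
  ℚ.∣ p * r - q * r ∣     ≡⟨ cong ℚ.∣_∣ (solve 3 (λ p q r → p :* r :- q :* r := (p :- q) :* r) refl p q r) ⟩
  ℚ.∣ (p - q) * r ∣       ≡⟨ ∣p*q∣≡∣p∣*∣q∣ (p - q) r ⟩
  ℚ.∣ p - q ∣ * ℚ.∣ r ∣   ≤⟨ *-mono-≤-nonNeg (nonNegative⁻¹ _ {{∣-∣-nonNeg (p - q)}}) (nonNegative⁻¹ _ {{∣-∣-nonNeg r}}) ∣p-q∣≤w ∣r∣≤K ⟩
  w * K                   ∎
  where open ≤-Reasoning

∣u*v-a*c∣≤ : ∀ {u v a c w K} → ℚ.∣ u - a ∣ ≤ w → ℚ.∣ v - c ∣ ≤ w → ℚ.∣ u ∣ ≤ K → ℚ.∣ c ∣ ≤ K →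
             ℚ.∣ u * v - a * c ∣ ≤ w * K + w * K
∣u*v-a*c∣≤ {u} {v} {a} {c} {w} {K} ∣u-a∣≤w ∣v-c∣≤w ∣u∣≤K ∣c∣≤K = begin
  ℚ.∣ u * v - a * c ∣
    ≡⟨ cong ℚ.∣_∣ (solve 4 (λ u v a c → u :* v :- a :* c := (v :* u :- c :* u) :+ (u :* c :- a :* c)) refl u v a c) ⟩
  ℚ.∣ (v * u - c * u) + (u * c - a * c) ∣
    ≤⟨ ∣p+q∣≤∣p∣+∣q∣ (v * u - c * u) (u * c - a * c) ⟩
  ℚ.∣ v * u - c * u ∣ + ℚ.∣ u * c - a * c ∣
    ≤⟨ +-mono-≤ (∣p*r-q*r∣≤ {v} {c} ∣v-c∣≤w ∣u∣≤K) (∣p*r-q*r∣≤ {u} {a} ∣u-a∣≤w ∣c∣≤K) ⟩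
  w * K + w * K
    ∎
  where open ≤-Reasoning

module ProductCut (PT : PropTrunc) (x y : Cut) where
  open Reals PT

  mulᶜ-lower : ∀ {q a b c d} → q < min4 (a * c) (a * d) (b * c) (b * d) →
               lower x a → upper x b → lower y c → upper y d → lower (mulᶜ x y) q
  mulᶜ-lower q<min xa xb yc yd = ∣ _ , _ , _ , _ , q<min , (xa , xb) , (yc , yd) ∣

  mulᶜ-upper : ∀ {r a b c d} → max4 (a * c) (a * d) (b * c) (b * d) < r →
               lower x a → upper x b → lower y c → upper y d → upper (mulᶜ x y) r
  mulᶜ-upper max<r xa xb yc yd = ∣ _ , _ , _ , _ , max<r , (xa , xb) , (yc , yd) ∣

-- The corners of [t - η, t + η] × [c, d] lie within η K of t c and t d.
module RationalMultiple (PT : PropTrunc) (z : Cut) {c d : ℚ} (zc : lower z c) (zd : upper z d) where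
  open Reals PT

  K : ℚ
  K = ℚ.∣ c ∣ ⊔ ℚ.∣ d ∣

  0≤K : 0ℚ ≤ K
  0≤K = ≤-trans (nonNegative⁻¹ _ {{∣-∣-nonNeg c}}) (p≤p⊔q ℚ.∣ c ∣ ℚ.∣ d ∣)

  module Corners (t η : ℚ) (0<η : 0ℚ < η) where
    corner : ∀ {u v} → u ≡ t - η ⊎ u ≡ t + η → v ≡ c ⊎ v ≡ d →
             t * v - η * K ≤ u * v × u * v ≤ t * v + η * K
    corner {u} {v} u≡t±η v≡c∨d = ∣p-q∣≤ε⇒q-ε≤p≤q+ε {u * v} {t * v} (∣p*r-q*r∣≤ {u} {t} (∣u-t∣≤η u≡t±η) (∣v∣≤K v≡c∨d))
      where
      ∣u-t∣≤η : ∀ {u} → u ≡ t - η ⊎ u ≡ t + η → ℚ.∣ u - t ∣ ≤ η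
      ∣u-t∣≤η (inj₁ refl) = ∣p-ε-p∣≤ε t (<⇒≤ 0<η)
      ∣u-t∣≤η (inj₂ refl) = ∣p+ε-p∣≤ε t (<⇒≤ 0<η)
      ∣v∣≤K : ∀ {v} → v ≡ c ⊎ v ≡ d → ℚ.∣ v ∣ ≤ K
      ∣v∣≤K (inj₁ refl) = p≤p⊔q ℚ.∣ c ∣ ℚ.∣ d ∣
      ∣v∣≤K (inj₂ refl) = p≤q⊔p ℚ.∣ c ∣ ℚ.∣ d ∣

  ι*-upper : ∀ {t m s} → t * c ≤ m → t * d ≤ m → m < s → upper (mulᶜ (ι t) z) s
  ι*-upper {t} {m} {s} tc≤m td≤m m<s = withRadius (small-factor 0≤K (p<q⇒0<q-p m<s))
    where
    open ProductCut PT (ι t) z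
    withRadius : Σ ℚ (λ η → 0ℚ < η × η ≤ 1ℚ × η * K < s - m) → upper (mulᶜ (ι t) z) s
    withRadius (η , 0<η , _ , ηK<s-m) =
      mulᶜ-upper {a = t - η} {t + η} {c} {d} (≤-<-trans max4≤ (p<q-r⇒r+p<q ηK<s-m)) (p-q<p t 0<η) (p<p+q t 0<η) zc zd
      where
      open Corners t η 0<η
      bound : ∀ {u v} → u ≡ t - η ⊎ u ≡ t + η → v ≡ c ⊎ v ≡ d → t * v ≤ m → u * v ≤ m + η * K
      bound u≡ v≡ tv≤m = ≤-trans (proj₂ (corner u≡ v≡)) (+-monoˡ-≤ (η * K) tv≤m)
      max4≤ : max4 ((t - η) * c) ((t - η) * d) ((t + η) * c) ((t + η) * d) ≤ m + η * K
      max4≤ = ⊔-lub (⊔-lub (bound (inj₁ refl) (inj₁ refl) tc≤m) (bound (inj₁ refl) (inj₂ refl) td≤m))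
                    (⊔-lub (bound (inj₂ refl) (inj₁ refl) tc≤m) (bound (inj₂ refl) (inj₂ refl) td≤m))

  ι*-lower : ∀ {t m s} → m ≤ t * c → m ≤ t * d → s < m → lower (mulᶜ (ι t) z) s
  ι*-lower {t} {m} {s} m≤tc m≤td s<m = withRadius (small-factor 0≤K (p<q⇒0<q-p s<m))
    where
    open ProductCut PT (ι t) z
    withRadius : Σ ℚ (λ η → 0ℚ < η × η ≤ 1ℚ × η * K < m - s) → lower (mulᶜ (ι t) z) s
    withRadius (η , 0<η , _ , ηK<m-s) =
      mulᶜ-lower {a = t - η} {t + η} {c} {d} (<-≤-trans (p<q-r⇒r<q-p {η * K} {m} {s} ηK<m-s) min4≥) (p-q<p t 0<η) (p<p+q t 0<η) zc zd
      where
      open Corners t η 0<η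
      bound : ∀ {u v} → u ≡ t - η ⊎ u ≡ t + η → v ≡ c ⊎ v ≡ d → m ≤ t * v → m - η * K ≤ u * v
      bound u≡ v≡ m≤tv = ≤-trans (+-monoˡ-≤ (- (η * K)) m≤tv) (proj₁ (corner u≡ v≡))
      min4≥ : m - η * K ≤ min4 ((t - η) * c) ((t - η) * d) ((t + η) * c) ((t + η) * d)
      min4≥ = ⊓-glb (⊓-glb (bound (inj₁ refl) (inj₁ refl) m≤tc) (bound (inj₁ refl) (inj₂ refl) m≤td))
                    (⊓-glb (bound (inj₂ refl) (inj₁ refl) m≤tc) (bound (inj₂ refl) (inj₂ refl) m≤td))

  ι*-below : ∀ {t m s} → t * c ≤ m → t * d ≤ m → m < s → mulᶜ (ι t) z <ᶜ ι s
  ι*-below tc≤m td≤m m<s =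
    let s′ , m<s′ , s′<s = <-dense m<s in ∣ s′ , ι*-upper tc≤m td≤m m<s′ , s′<s ∣

  ι*-above : ∀ {t m s} → m ≤ t * c → m ≤ t * d → s < m → ι s <ᶜ mulᶜ (ι t) z
  ι*-above m≤tc m≤td s<m =
    let s′ , s<s′ , s′<m = <-dense s<m in ∣ s′ , s<s′ , ι*-lower m≤tc m≤td s′<m ∣

-- Bounds, enclosures and sign from a locator

module Located (PT : PropTrunc) (x : Reals.ℝD PT) (ℓ : Locator (Reals.cutOf PT x)) where
  open Reals PT
  open ℝD x
  open UniqueChoice PT

  L-down : ∀ {q q′} → L q′ → q < q′ → L q
  L-down {q} {q′} Lq′ q<q′ = proj₂ (rounded-L q) ∣ q′ , q<q′ , Lq′ ∣

  U-up : ∀ {r′ r} → U r′ → r′ < r → U r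
  U-up {r′} {r} Ur′ r′<r = proj₂ (rounded-U r) ∣ r′ , r′<r , Ur′ ∣

  U-up-≤ : ∀ {r′ r} → U r′ → r′ ≤ r → U r
  U-up-≤ {r′} {r} Ur′ r′≤r with <-cmp r′ r
  ... | tri< r′<r _ _ = U-up Ur′ r′<r
  ... | tri≈ _ refl _ = Ur′
  ... | tri> _ _ r<r′ = ⊥-elim (<-irrefl refl (≤-<-trans r′≤r r<r′))

  lowerBound : Σ ℚ L
  lowerBound = _ , proj₂ (searchInj₁ step (∥∥-rec ∥∥-isProp eventually bounded-L))
    where
    step : ∀ n → L (- (fromℕ n + 1ℚ)) ⊎ U (- fromℕ n)
    step n = ℓ _ _ (neg-antimono-< (p<p+q (fromℕ n) 0<1))
    eventually : Σ ℚ L → ∥ Σ ℕ (λ n → ¬ U (- fromℕ n)) ∥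
    eventually (q , Lq) =
      let n , -q<n = archimedean (- q)
      in ∣ n , (λ U-n → <-asym (transitive _ _ Lq U-n) (subst (- fromℕ n <_) (neg-involutive q) (neg-antimono-< -q<n))) ∣

  upperBound : Σ ℚ U
  upperBound = _ , proj₂ (searchInj₁ step (∥∥-rec ∥∥-isProp eventually bounded-U))
    where
    step : ∀ n → U (fromℕ n + 1ℚ) ⊎ L (fromℕ n)
    step n = swap (ℓ _ _ (p<p+q (fromℕ n) 0<1))
    eventually : Σ ℚ U → ∥ Σ ℕ (λ n → ¬ L (fromℕ n)) ∥
    eventually (r , Ur) = let n , r<n = archimedean r in ∣ n , (λ Ln → <-asym (transitive _ _ Ln Ur) r<n) ∣

  lo hi : ℚ
  lo = proj₁ lowerBound
  hi = proj₁ upperBound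

  -- Steps of size η up from s; after N steps L would reach hi, which is impossible.
  scan : ∀ {η δ} → 0ℚ < η → η < δ → ∀ N s → L s → hi ≤ s + fromℕ N * η →
         Σ ℚ λ a → s ≤ a × L a × U (a + δ)
  scan {η} 0<η η<δ zero s Ls hi≤s+0η =
    ⊥-elim (<-irrefl refl (<-≤-trans (transitive s hi Ls (proj₂ upperBound))
                                     (≤-trans hi≤s+0η (≤-reflexive (trans (cong (s +_) (*-zeroˡ η)) (+-identityʳ s))))))
  scan {η} {δ} 0<η η<δ (suc N) s Ls hi≤ = step (ℓ (s + η) (s + δ) (+-monoʳ-< s η<δ))
    where
    step : L (s + η) ⊎ U (s + δ) → Σ ℚ λ a → s ≤ a × L a × U (a + δ)
    step (inj₂ Us+δ) = s , ≤-refl , Ls , Us+δ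
    step (inj₁ Ls+η) =
      let a , s+η≤a , La , Ua+δ = scan 0<η η<δ N (s + η) Ls+η (subst (hi ≤_) (+-fromℕ-suc-* s η N) hi≤)
      in a , ≤-trans (<⇒≤ (p<p+q s 0<η)) s+η≤a , La , Ua+δ

  approximate : ∀ {δ} → 0ℚ < δ → Σ ℚ λ a → lo ≤ a × L a × U (a + δ)
  approximate {δ} 0<δ =
    let 0<½δ , ½δ<δ = halve 0<δ
        N , hi-lo<N½δ = archimedean-scaled 0<½δ (hi - lo)
    in scan 0<½δ ½δ<δ N lo (proj₂ lowerBound)
         (<⇒≤ (subst (_< lo + fromℕ N * (½ * δ)) (solve 2 (λ lo hi → lo :+ (hi :- lo) := hi) refl lo hi)
                      (+-monoʳ-< lo hi-lo<N½δ)))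

  radius : ℚ
  radius = ℚ.∣ lo ∣ ⊔ ℚ.∣ hi + 1ℚ ∣

  0≤radius : 0ℚ ≤ radius
  0≤radius = ≤-trans (nonNegative⁻¹ _ {{∣-∣-nonNeg lo}}) (p≤p⊔q ℚ.∣ lo ∣ ℚ.∣ hi + 1ℚ ∣)

  enclose : ∀ {w} → 0ℚ < w → w ≤ 1ℚ →
            Σ ℚ λ a → L a × U (a + w) × ℚ.∣ a ∣ ≤ radius × ℚ.∣ a + w ∣ ≤ radius
  enclose {w} 0<w w≤1 =
    let a , lo≤a , La , Ua+w = approximate 0<w
        a<hi = transitive a hi La (proj₂ upperBound)
    in a , La , Ua+w ,
       ∣p∣≤∣q∣⊔∣r∣ lo≤a (<⇒≤ (<-trans a<hi (p<p+q hi 0<1))) ,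
       ∣p∣≤∣q∣⊔∣r∣ (≤-trans lo≤a (<⇒≤ (p<p+q a 0<w))) (+-mono-≤ (<⇒≤ a<hi) w≤1)

  Sign : Set
  Sign = (cutOf x <ᶜ ι 0ℚ) ⊎ (ι 0ℚ <ᶜ cutOf x)

  signAt : ∀ {ε} → 0ℚ < ε → Sign ⊎ (L (- ε) × U ε)
  signAt {ε} 0<ε = fromAbove (ℓ 0ℚ ε 0<ε)
    where
    fromBelow : U ε → L (- ε) ⊎ U 0ℚ → Sign ⊎ (L (- ε) × U ε)
    fromBelow Uε (inj₁ L-ε) = inj₂ (L-ε , Uε)
    fromBelow Uε (inj₂ U0)  = inj₁ (inj₁ (∥∥-rec ∥∥-isProp (λ (r , r<0 , Ur) → ∣ r , Ur , r<0 ∣) (proj₁ (rounded-U 0ℚ) U0)))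
    fromAbove : L 0ℚ ⊎ U ε → Sign ⊎ (L (- ε) × U ε)
    fromAbove (inj₁ L0) = inj₁ (inj₂ (proj₁ (rounded-L 0ℚ) L0))
    fromAbove (inj₂ Uε) = fromBelow Uε (ℓ (- ε) 0ℚ (neg-antimono-< 0<ε))

  sign : cutOf x #0 → Sign
  sign x#0 = proj₂ (searchInj₁ (λ n → signAt (0<unitFraction n)) (∥∥-rec ∥∥-isProp eventually x#0))
    where
    eventually : Sign → ∥ Σ ℕ (λ n → ¬ (L (- unitFraction n) × U (unitFraction n))) ∥
    eventually (inj₁ x<0) = ∥∥-rec ∥∥-isProp (λ (p , Up , p<0) →
      let n , εₙ≤-p = unitFraction-≤ (neg-antimono-< p<0)
          p≤-εₙ = subst (_≤ - unitFraction n) (neg-involutive p) (neg-antimono-≤ εₙ≤-p)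
      in ∣ n , (λ (L-εₙ , _) → <-irrefl refl (<-≤-trans (transitive _ _ L-εₙ Up) p≤-εₙ)) ∣) x<0
    eventually (inj₂ 0<x) = ∥∥-rec ∥∥-isProp (λ (p , 0<p , Lp) →
      let n , εₙ≤p = unitFraction-≤ 0<p
      in ∣ n , (λ (_ , Uεₙ) → <-irrefl refl (<-≤-trans (transitive _ _ Lp Uεₙ) εₙ≤p)) ∣) 0<x

-- Locators for the operations

module PointwiseLocators (PT : PropTrunc) {x y : Cut} (ℓx : Locator x) (ℓy : Locator y) where
  open Reals PT

  negᶜ-locator : Locator (negᶜ x)
  negᶜ-locator q r q<r = swap (ℓx (- r) (- q) (neg-antimono-< q<r))

  minᶜ-locator : Locator (minᶜ x y)
  minᶜ-locator q r q<r =
    [ (λ xq → Sum.map (xq ,_) (∣_∣ ∘ inj₂) (ℓy q r q<r)) , inj₂ ∘ ∣_∣ ∘ inj₁ ]′ (ℓx q r q<r)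

  maxᶜ-locator : Locator (maxᶜ x y)
  maxᶜ-locator q r q<r =
    [ inj₁ ∘ ∣_∣ ∘ inj₁ , (λ xr → Sum.map (∣_∣ ∘ inj₂) (xr ,_) (ℓy q r q<r)) ]′ (ℓx q r q<r)

module SumLocator (PT : PropTrunc) (x y : Reals.ℝD PT)
                  (ℓx : Locator (Reals.cutOf PT x)) (ℓy : Locator (Reals.cutOf PT y)) where
  open Reals PT
  module X = Located PT x ℓx
  module Y = Located PT y ℓy

  -- Enclosures of width δ = (r - q)/2 suffice: their left ends a, c either have q < a + c,
  -- or a + c ≤ q and then the right ends sum to at most r.
  addᶜ-locator : Locator (addᶜ (cutOf x) (cutOf y))
  addᶜ-locator q r q<r = decide (X.approximate 0<δ) (Y.approximate 0<δ)
    where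
    δ : ℚ
    δ = ½ * (r - q)
    0<δ : 0ℚ < δ
    0<δ = proj₁ (halve (p<q⇒0<q-p q<r))
    decide : Σ ℚ (λ a → X.lo ≤ a × ℝD.L x a × ℝD.U x (a + δ)) → Σ ℚ (λ c → Y.lo ≤ c × ℝD.L y c × ℝD.U y (c + δ)) →
             lower (addᶜ (cutOf x) (cutOf y)) q ⊎ upper (addᶜ (cutOf x) (cutOf y)) r
    decide (a , _ , La , Ua+δ) (c , _ , Lc , Uc+δ) = compare (q <? a + c)
      where
      open ≤-Reasoning
      compare : Dec (q < a + c) → lower (addᶜ (cutOf x) (cutOf y)) q ⊎ upper (addᶜ (cutOf x) (cutOf y)) r
      compare (yes q<a+c) = inj₁ ∣ a , La , Y.L-down Lc q-a<c ∣
        where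
        q-a<c : q - a < c
        q-a<c = subst (q - a <_) (solve 2 (λ a c → a :+ c :- a := c) refl a c) (+-monoˡ-< (- a) q<a+c)
      compare (no q≮a+c) = inj₂ ∣ a + δ , Ua+δ , Y.U-up-≤ Uc+δ c+δ≤r-[a+δ] ∣
        where
        c+δ≤r-[a+δ] : c + δ ≤ r - (a + δ)
        c+δ≤r-[a+δ] = begin
          c + δ                      ≡⟨ solve 3 (λ a c δ → c :+ δ := a :+ c :+ (δ :+ δ) :- (a :+ δ)) refl a c δ ⟩
          a + c + (δ + δ) - (a + δ)  ≤⟨ +-monoˡ-≤ (- (a + δ)) (+-monoˡ-≤ (δ + δ) (≮⇒≥ q≮a+c)) ⟩
          q + (δ + δ) - (a + δ)      ≡⟨ solve 3 (λ q r a → q :+ (con ½ :* (r :- q) :+ con ½ :* (r :- q)) :- (a :+ con ½ :* (r :- q))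
                                                      := r :- (a :+ con ½ :* (r :- q))) refl q r a ⟩
          r - (a + δ)                ∎

module ProductLocator (PT : PropTrunc) (x y : Reals.ℝD PT)
                      (ℓx : Locator (Reals.cutOf PT x)) (ℓy : Locator (Reals.cutOf PT y)) where
  open Reals PT
  open ProductCut PT (cutOf x) (cutOf y)
  module X = Located PT x ℓx
  module Y = Located PT y ℓy

  corner-bounds : ∀ {a c w K} → 0ℚ ≤ w → ℚ.∣ a ∣ ≤ K → ℚ.∣ a + w ∣ ≤ K → ℚ.∣ c ∣ ≤ K →
                  a * c - (w * K + w * K) ≤ min4 (a * c) (a * (c + w)) ((a + w) * c) ((a + w) * (c + w)) ×
                  max4 (a * c) (a * (c + w)) ((a + w) * c) ((a + w) * (c + w)) ≤ a * c + (w * K + w * K)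
  corner-bounds {a} {c} {w} {K} 0≤w ∣a∣≤K ∣a+w∣≤K ∣c∣≤K =
    ⊓-glb (⊓-glb (proj₁ near-ac) (proj₁ near-ad)) (⊓-glb (proj₁ near-bc) (proj₁ near-bd)) ,
    ⊔-lub (⊔-lub (proj₂ near-ac) (proj₂ near-ad)) (⊔-lub (proj₂ near-bc) (proj₂ near-bd))
    where
    ε : ℚ
    ε = w * K + w * K
    near : ∀ {u v} → ℚ.∣ u - a ∣ ≤ w → ℚ.∣ v - c ∣ ≤ w → ℚ.∣ u ∣ ≤ K → a * c - ε ≤ u * v × u * v ≤ a * c + ε
    near {u} {v} ∣u-a∣≤w ∣v-c∣≤w ∣u∣≤K = ∣p-q∣≤ε⇒q-ε≤p≤q+ε {u * v} {a * c} (∣u*v-a*c∣≤ ∣u-a∣≤w ∣v-c∣≤w ∣u∣≤K ∣c∣≤K)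
    near-ac : a * c - ε ≤ a * c × a * c ≤ a * c + ε
    near-ac = near {a} {c} (∣p-p∣≤ε a 0≤w) (∣p-p∣≤ε c 0≤w) ∣a∣≤K
    near-ad : a * c - ε ≤ a * (c + w) × a * (c + w) ≤ a * c + ε
    near-ad = near {a} {c + w} (∣p-p∣≤ε a 0≤w) (∣p+ε-p∣≤ε c 0≤w) ∣a∣≤K
    near-bc : a * c - ε ≤ (a + w) * c × (a + w) * c ≤ a * c + ε
    near-bc = near {a + w} {c} (∣p+ε-p∣≤ε a 0≤w) (∣p-p∣≤ε c 0≤w) ∣a+w∣≤K
    near-bd : a * c - ε ≤ (a + w) * (c + w) × (a + w) * (c + w) ≤ a * c + ε
    near-bd = near {a + w} {c + w} (∣p+ε-p∣≤ε a 0≤w) (∣p+ε-p∣≤ε c 0≤w) ∣a+w∣≤K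

  K : ℚ
  K = X.radius ⊔ Y.radius

  0≤4K : 0ℚ ≤ K + K + (K + K)
  0≤4K = +-mono-≤ (+-mono-≤ 0≤K 0≤K) (+-mono-≤ 0≤K 0≤K)
    where
    0≤K : 0ℚ ≤ K
    0≤K = ≤-trans X.0≤radius (p≤p⊔q X.radius Y.radius)

  -- The enclosures have width w with 4 w K < r - q, so all four corner products lie within
  -- ε = 2 w K of a c and 2 ε < r - q.
  mulᶜ-locator : Locator (mulᶜ (cutOf x) (cutOf y))
  mulᶜ-locator q r q<r = withWidth (small-factor 0≤4K (p<q⇒0<q-p q<r))
    where
    withWidth : Σ ℚ (λ w → 0ℚ < w × w ≤ 1ℚ × w * (K + K + (K + K)) < r - q) →
                lower (mulᶜ (cutOf x) (cutOf y)) q ⊎ upper (mulᶜ (cutOf x) (cutOf y)) r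
    withWidth (w , 0<w , w≤1 , w4K<r-q) = decide (X.enclose 0<w w≤1) (Y.enclose 0<w w≤1)
      where
      ε : ℚ
      ε = w * K + w * K
      2ε<r-q : ε + ε < r - q
      2ε<r-q = subst (_< r - q) (solve 2 (λ w K → w :* (K :+ K :+ (K :+ K)) := w :* K :+ w :* K :+ (w :* K :+ w :* K)) refl w K) w4K<r-q
      decide : Σ ℚ (λ a → ℝD.L x a × ℝD.U x (a + w) × ℚ.∣ a ∣ ≤ X.radius × ℚ.∣ a + w ∣ ≤ X.radius) →
               Σ ℚ (λ c → ℝD.L y c × ℝD.U y (c + w) × ℚ.∣ c ∣ ≤ Y.radius × ℚ.∣ c + w ∣ ≤ Y.radius) →
               lower (mulᶜ (cutOf x) (cutOf y)) q ⊎ upper (mulᶜ (cutOf x) (cutOf y)) r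
      decide (a , La , Ua+w , ∣a∣≤ , ∣a+w∣≤) (c , Lc , Uc+w , ∣c∣≤ , _) = compare (q <? a * c - ε)
        where
        inX : X.radius ≤ K
        inX = p≤p⊔q X.radius Y.radius
        bounds : a * c - ε ≤ min4 (a * c) (a * (c + w)) ((a + w) * c) ((a + w) * (c + w)) ×
                 max4 (a * c) (a * (c + w)) ((a + w) * c) ((a + w) * (c + w)) ≤ a * c + ε
        bounds = corner-bounds (<⇒≤ 0<w) (≤-trans ∣a∣≤ inX) (≤-trans ∣a+w∣≤ inX) (≤-trans ∣c∣≤ (p≤q⊔p X.radius Y.radius))
        compare : Dec (q < a * c - ε) → lower (mulᶜ (cutOf x) (cutOf y)) q ⊎ upper (mulᶜ (cutOf x) (cutOf y)) r
        compare (yes q<ac-ε) =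
          inj₁ (mulᶜ-lower {a = a} {a + w} {c} {c + w} (<-≤-trans q<ac-ε (proj₁ bounds)) La Ua+w Lc Uc+w)
        compare (no q≮ac-ε) =
          inj₂ (mulᶜ-upper {a = a} {a + w} {c} {c + w} (≤-<-trans (proj₂ bounds) (p-ε≤q⇒p+ε<r {a * c} {q} {r} {ε} (≮⇒≥ q≮ac-ε) 2ε<r-q)) La Ua+w Lc Uc+w)

module ReciprocalLocator (PT : PropTrunc) (x : Reals.ℝD PT) (ℓ : Locator (Reals.cutOf PT x)) where
  open Reals PT
  open ℝD x
  open Located PT x ℓ using (sign)

  z : Cut
  z = cutOf x

  module Times {c d : ℚ} (Lc : L c) (Ud : U d) = RationalMultiple PT z Lc Ud

  lower-inv-nonPos : ι 0ℚ <ᶜ z → ∀ {q} → q ≤ 0ℚ → lower (invᶜ z) q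
  lower-inv-nonPos 0<z {q} q≤0 = ∥∥-rec ∥∥-isProp (λ (d , Ud) → ∥∥-rec ∥∥-isProp (λ (p , 0<p , Lp) →
    let 0≤d = <⇒≤ (<-trans 0<p (transitive p d Lp Ud))
    in ∣ inj₁ (0<z , Times.ι*-below Lp Ud (nonPos*nonNeg≤0 q≤0 (<⇒≤ 0<p)) (nonPos*nonNeg≤0 q≤0 0≤d) 0<1) ∣) 0<z) bounded-U

  lower-inv-pos : ι 0ℚ <ᶜ z → ∀ {q v} → 0ℚ < q → q * v < 1ℚ → U v → lower (invᶜ z) q
  lower-inv-pos 0<z {q} 0<q qv<1 Uv = ∥∥-rec ∥∥-isProp (λ (p , 0<p , Lp) →
    let qp≤qv = *-monoˡ-≤-nonNeg q {{nonNegative (<⇒≤ 0<q)}} (<⇒≤ (transitive _ _ Lp Uv))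
    in ∣ inj₁ (0<z , Times.ι*-below Lp Uv qp≤qv ≤-refl qv<1) ∣) 0<z

  upper-inv-pos : ι 0ℚ <ᶜ z → ∀ {r u} → 0ℚ < r → 1ℚ < r * u → L u → upper (invᶜ z) r
  upper-inv-pos 0<z {r} 0<r 1<ru Lu = ∥∥-rec ∥∥-isProp (λ (d , Ud) →
    let ru≤rd = *-monoˡ-≤-nonNeg r {{nonNegative (<⇒≤ 0<r)}} (<⇒≤ (transitive _ _ Lu Ud))
    in ∣ inj₁ (0<z , Times.ι*-above Lu Ud ≤-refl ru≤rd 1<ru) ∣) bounded-U

  upper-inv-nonNeg : z <ᶜ ι 0ℚ → ∀ {r} → 0ℚ ≤ r → upper (invᶜ z) r
  upper-inv-nonNeg z<0 {r} 0≤r = ∥∥-rec ∥∥-isProp (λ (c , Lc) → ∥∥-rec ∥∥-isProp (λ (p , Up , p<0) →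
    let c≤0 = <⇒≤ (<-trans (transitive c p Lc Up) p<0)
    in ∣ inj₂ (z<0 , Times.ι*-below Lc Up (nonNeg*nonPos≤0 0≤r c≤0) (nonNeg*nonPos≤0 0≤r (<⇒≤ p<0)) 0<1) ∣) z<0) bounded-L

  upper-inv-neg : z <ᶜ ι 0ℚ → ∀ {r u} → r < 0ℚ → r * u < 1ℚ → L u → upper (invᶜ z) r
  upper-inv-neg z<0 {r} r<0 ru<1 Lu = ∥∥-rec ∥∥-isProp (λ (p , Up , p<0) →
    let rp≤ru = *-monoˡ-≤-nonPos r {{nonPositive (<⇒≤ r<0)}} (<⇒≤ (transitive _ _ Lu Up))
    in ∣ inj₂ (z<0 , Times.ι*-below Lu Up ≤-refl rp≤ru ru<1) ∣) z<0

  lower-inv-neg : z <ᶜ ι 0ℚ → ∀ {q v} → q < 0ℚ → 1ℚ < q * v → U v → lower (invᶜ z) q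
  lower-inv-neg z<0 {q} q<0 1<qv Uv = ∥∥-rec ∥∥-isProp (λ (c , Lc) →
    let qv≤qc = *-monoˡ-≤-nonPos q {{nonPositive (<⇒≤ q<0)}} (<⇒≤ (transitive _ _ Lc Uv))
    in ∣ inj₂ (z<0 , Times.ι*-above Lc Uv qv≤qc ≤-refl 1<qv) ∣) bounded-L

  invᶜ-locator-pos : ι 0ℚ <ᶜ z → Locator (invᶜ z)
  invᶜ-locator-pos 0<z q r q<r = byCases (0ℚ <? q)
    where
    byCases : Dec (0ℚ < q) → lower (invᶜ z) q ⊎ upper (invᶜ z) r
    byCases (no q≯0)  = inj₁ (lower-inv-nonPos 0<z (≮⇒≥ q≯0))
    byCases (yes 0<q) =
      let u , v , u<v , 1<ru , qv<1 = reciprocal-gap 0<q q<r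
      in swap (Sum.map (upper-inv-pos 0<z (<-trans 0<q q<r) 1<ru) (lower-inv-pos 0<z 0<q qv<1) (ℓ u v u<v))

  invᶜ-locator-neg : z <ᶜ ι 0ℚ → Locator (invᶜ z)
  invᶜ-locator-neg z<0 q r q<r = byCases (r <? 0ℚ)
    where
    byCases : Dec (r < 0ℚ) → lower (invᶜ z) q ⊎ upper (invᶜ z) r
    byCases (no r≮0)  = inj₂ (upper-inv-nonNeg z<0 (≮⇒≥ r≮0))
    byCases (yes r<0) =
      let u , v , u<v , ru<1 , 1<qv = reciprocal-gap-neg q<r r<0
      in swap (Sum.map (upper-inv-neg z<0 r<0 ru<1) (lower-inv-neg z<0 (<-trans q<r r<0) 1<qv) (ℓ u v u<v))

  invᶜ-locator : z #0 → Locator (invᶜ z)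
  invᶜ-locator z#0 = [ invᶜ-locator-neg , invᶜ-locator-pos ]′ (sign z#0)

theorem3p25 : (T : PropTrunc) → FunExt → PropExt →
    let open Reals T in
    (x y : ℝD) → Locator (cutOf x) → Locator (cutOf y) →
      Locator (negᶜ (cutOf x))
      × Locator (addᶜ (cutOf x) (cutOf y))
      × Locator (mulᶜ (cutOf x) (cutOf y))
      × Locator (minᶜ (cutOf x) (cutOf y))
      × Locator (maxᶜ (cutOf x) (cutOf y))
      × ((cutOf x) #0 → Locator (invᶜ (cutOf x)))
theorem3p25 PT _ _ x y ℓx ℓy =
  negᶜ-locator , addᶜ-locator , mulᶜ-locator , minᶜ-locator , maxᶜ-locator , invᶜ-locator
  where
  open PointwiseLocators PT ℓx ℓy
  open SumLocator PT x y ℓx ℓy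
  open ProductLocator PT x y ℓx ℓy
  open ReciprocalLocator PT x ℓx
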